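{- If $G$ is a graph that contains a pendent edge $e$, then $\mathrm{czf}(G)=\mathrm{czf}(G-e)+1$.
   Context: All graphs are finite and simple. A pendent edge is an edge $e=uv$ at least one of whose endpoints has degree $1$. Here $G-e$ denotes the graph obtained from $G$ by deleting the edge $e$ together with both of its endpoints $u$ and $v$. Constrained zero forcing: start with a set $S\subseteq V(G)$ of colored vertices, all others uncolored. A colored vertex $c$ may force an uncolored vertex $u$ to become colored if $u$ is the only uncolored neighbor of $c$; only vertices of the initial set $S$ may ever force. $S$ is a constrained zero forcing set if some sequence of forces colors all vertices. $\mathrm{czf}(G)$ is the minimum size of a constrained zero forcing set ($0$ for the graph with no vertices). -}

module Defs where

open import Data.Nat using (ℕ; suc; _≤_)
open import Data.Bool using (Bool; true; false)
open import Data.Fin using (Fin)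
open import Data.Fin.Subset using (Subset; _∈_; _∉_; _⊆_; _∪_; ⁅_⁆; ∣_∣; ⊤; _-_)
open import Data.Product using (Σ; ∃; _×_)
open import Data.Sum using (_⊎_)
open import Relation.Binary.PropositionalEquality using (_≡_; _≢_)

record Graph (n : ℕ) : Set where
  field
    adj    : Fin n → Fin n → Bool
    sym    : ∀ x y → adj x y ≡ adj y x
    irrefl : ∀ x → adj x x ≡ false
open Graph public

Adj : ∀ {n} → Graph n → Fin n → Fin n → Set
Adj G x y = adj G x y ≡ true

-- We work with induced subgraphs G[W] for a vertex set W ⊆ Fin n;
-- G itself is G[⊤], and G - e for e = uv is G[⊤ - u - v].

-- A force c → u requires
-- c ∈ S (only initial vertices force), u ∈ W uncoloured, c ~ u,
-- and every other neighbour of c in W already coloured.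
data Forces {n : ℕ} (G : Graph n) (W S : Subset n) : Subset n → Subset n → Set where
  done : ∀ {C} → Forces G W S C C
  step : ∀ {C D} (c u : Fin n) →
         c ∈ S → u ∈ W → u ∉ C → Adj G c u →
         (∀ w → w ∈ W → Adj G c w → w ≢ u → w ∈ C) →
         Forces G W S (C ∪ ⁅ u ⁆) D →
         Forces G W S C D

IsCZFS : ∀ {n} → Graph n → Subset n → Subset n → Set
IsCZFS G W S = S ⊆ W × ∃ λ D → Forces G W S S D × W ⊆ D

IsCzf : ∀ {n} → Graph n → Subset n → ℕ → Set
IsCzf G W k = (∃ λ S → IsCZFS G W S × ∣ S ∣ ≡ k)
            × (∀ S → IsCZFS G W S → k ≤ ∣ S ∣)

HasOnlyNeighbour : ∀ {n} → Graph n → Fin n → Fin n → Set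
HasOnlyNeighbour G x y = ∀ w → Adj G x w → w ≡ y

IsPendentEdge : ∀ {n} → Graph n → Fin n → Fin n → Set
IsPendentEdge G u v = Adj G u v × (HasOnlyNeighbour G u v ⊎ HasOnlyNeighbour G v u)

{-# OPTIONS --safe #-}
module Submission where

-- The leaf a of a pendent edge ab is coloured either initially or by its only neighbour b,
-- and b, like every vertex, forces at most once, say x. So for a constrained zero forcing
-- set S of G both a and b lie in S ∪ {x}, and (S ∪ {x}) - a - b, of size at most |S| - 1,
-- works for G - ab: each force of G into G - ab comes from S - a - b or is b forcing x.
-- Conversely, if S′ works for G - ab then S′ ∪ {a} works for G: a first forces b, after
-- which the forces of S′ stay valid in G, as the only vertices outside G - ab are a and b.

open import Defs
open import Data.Nat using (ℕ; suc; _≤_; s≤s; s≤s⁻¹)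
open import Data.Nat.Properties using (≤-trans; ≤-refl; n≤1+n; ≤-antisym)
open import Data.Fin using (Fin; zero; suc; _≟_)
open import Data.Fin.Subset using (Subset; _∈_; _∉_; _⊆_; _─_; _∪_; ⁅_⁆; ∣_∣; ⊤; _-_; inside; outside)
open import Data.Fin.Subset.Properties
  using (_∈?_; ∈⊤; p⊆p∪q; q⊆p∪q; x∈p∪q⁻; x∈⁅x⁆; x∈⁅y⁆⇒x≡y; p─q⊆p; x∈p∧x≢y⇒x∈p-y;
         x∈p⇒∣p-x∣<∣p∣; ∪-identityʳ; p─x─y≡p─y─x)
open import Data.Vec.Base using (_∷_; here; there)
open import Data.Product using (∃; _×_; _,_)
open import Data.Sum using (_⊎_; inj₁; inj₂)
open import Data.Empty using (⊥; ⊥-elim)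
open import Relation.Nullary using (yes; no; ¬_)
open import Function using (_∘_)
open import Relation.Binary.PropositionalEquality using (_≡_; _≢_; ≢-sym; refl; trans; subst)
  renaming (sym to ≡-sym)

∣p∪⁅x⁆∣≤1+∣p∣ : ∀ {n} (p : Subset n) (x : Fin n) → ∣ p ∪ ⁅ x ⁆ ∣ ≤ suc ∣ p ∣
∣p∪⁅x⁆∣≤1+∣p∣ (inside ∷ p)  zero    rewrite ∪-identityʳ p = n≤1+n _
∣p∪⁅x⁆∣≤1+∣p∣ (outside ∷ p) zero    rewrite ∪-identityʳ p = ≤-refl
∣p∪⁅x⁆∣≤1+∣p∣ (inside ∷ p)  (suc x) = s≤s (∣p∪⁅x⁆∣≤1+∣p∣ p x)
∣p∪⁅x⁆∣≤1+∣p∣ (outside ∷ p) (suc x) = ∣p∪⁅x⁆∣≤1+∣p∣ p x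

x∈p─q⇒x∉q : ∀ {n} {p q : Subset n} {x : Fin n} → x ∈ p ─ q → x ∉ q
x∈p─q⇒x∉q {p = inside ∷ p} {outside ∷ q} here ()
x∈p─q⇒x∉q {p = _ ∷ p}      {_ ∷ q}       (there x∈p─q) (there x∈q) = x∈p─q⇒x∉q {p = p} x∈p─q x∈q

x∈p-y⁻ : ∀ {n} {p : Subset n} {x y : Fin n} → x ∈ p - y → x ∈ p × x ≢ y
x∈p-y⁻ {p = p} {x} {y} x∈p-y =
  p─q⊆p p ⁅ y ⁆ x∈p-y , λ { refl → x∈p─q⇒x∉q {p = p} x∈p-y (x∈⁅x⁆ x) }

x∈p-y-z⁻ : ∀ {n} {p : Subset n} {x y z : Fin n} → x ∈ p - y - z → x ∈ p × x ≢ y × x ≢ z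
x∈p-y-z⁻ x∈p-y-z with x∈p-y⁻ x∈p-y-z
... | x∈p-y , x≢z with x∈p-y⁻ x∈p-y
...   | x∈p , x≢y = x∈p , x≢y , x≢z

x∈p-y-z⁺ : ∀ {n} {p : Subset n} {x y z : Fin n} → x ∈ p → x ≢ y → x ≢ z → x ∈ p - y - z
x∈p-y-z⁺ x∈p x≢y x≢z = x∈p∧x≢y⇒x∈p-y (x∈p∧x≢y⇒x∈p-y x∈p x≢y) x≢z

x∉⊤-y-z⇒x≡y⊎x≡z : ∀ {n} {x y z : Fin n} → x ∉ ⊤ - y - z → x ≡ y ⊎ x ≡ z
x∉⊤-y-z⇒x≡y⊎x≡z {x = x} {y} {z} x∉ with x ≟ y | x ≟ z
... | yes x≡y | _       = inj₁ x≡y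
... | no _    | yes x≡z = inj₂ x≡z
... | no x≢y  | no x≢z  = ⊥-elim (x∉ (x∈p-y-z⁺ ∈⊤ x≢y x≢z))

x∈p∪⁅y⁆⁻ : ∀ {n} {p : Subset n} {x y : Fin n} → x ∈ p ∪ ⁅ y ⁆ → x ∈ p ⊎ x ≡ y
x∈p∪⁅y⁆⁻ {p = p} {y = y} x∈ with x∈p∪q⁻ p ⁅ y ⁆ x∈
... | inj₁ x∈p    = inj₁ x∈p
... | inj₂ x∈⁅y⁆ = inj₂ (x∈⁅y⁆⇒x≡y y x∈⁅y⁆)

x∈p⇒x∈p∪⁅y⁆ : ∀ {n} {p : Subset n} {x y : Fin n} → x ∈ p → x ∈ p ∪ ⁅ y ⁆
x∈p⇒x∈p∪⁅y⁆ {y = y} = p⊆p∪q ⁅ y ⁆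

y∈p∪⁅y⁆ : ∀ {n} {p : Subset n} {y : Fin n} → y ∈ p ∪ ⁅ y ⁆
y∈p∪⁅y⁆ {p = p} {y} = q⊆p∪q p ⁅ y ⁆ (x∈⁅x⁆ y)

2+∣p-x-y∣≤∣p∣ : ∀ {n} {p : Subset n} {x y : Fin n} → x ∈ p → y ∈ p → x ≢ y →
                suc (suc ∣ p - x - y ∣) ≤ ∣ p ∣
2+∣p-x-y∣≤∣p∣ x∈p y∈p x≢y =
  ≤-trans (s≤s (x∈p⇒∣p-x∣<∣p∣ (x∈p∧x≢y⇒x∈p-y y∈p (≢-sym x≢y)))) (x∈p⇒∣p-x∣<∣p∣ x∈p)

Adj-sym : ∀ {n} (G : Graph n) {x y : Fin n} → Adj G x y → Adj G y x
Adj-sym G {x} {y} x~y = trans (sym G y x) x~y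

Adj-irrefl : ∀ {n} (G : Graph n) {x y : Fin n} → Adj G x y → x ≢ y
Adj-irrefl G {x} x~y refl with trans (≡-sym x~y) (irrefl G x)
... | ()

module _ {n : ℕ} {G : Graph n} where

  infix 4 _⇝_∈_
  _⇝_∈_ : ∀ {W S C D} → Fin n → Fin n → Forces G W S C D → Set
  c ⇝ y ∈ done                   = ⊥
  c ⇝ y ∈ step c′ y′ _ _ _ _ _ r = (c ≡ c′ × y ≡ y′) ⊎ c ⇝ y ∈ r

  forcer-initial : ∀ {W S C D c y} {r : Forces G W S C D} → c ⇝ y ∈ r → c ∈ S
  forcer-initial {r = step _ _ c∈S _ _ _ _ _} (inj₁ (refl , refl)) = c∈S
  forcer-initial {r = step _ _ _ _ _ _ _ r}   (inj₂ c⇝y)          = forcer-initial c⇝y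

  forcer-adjacent : ∀ {W S C D c y} {r : Forces G W S C D} → c ⇝ y ∈ r → Adj G c y
  forcer-adjacent {r = step _ _ _ _ _ c~y _ _} (inj₁ (refl , refl)) = c~y
  forcer-adjacent {r = step _ _ _ _ _ _ _ r}   (inj₂ c⇝y)          = forcer-adjacent c⇝y

  forces-increasing : ∀ {W S C D} → Forces G W S C D → C ⊆ D
  forces-increasing done                   x∈C = x∈C
  forces-increasing (step _ _ _ _ _ _ _ r) x∈C = forces-increasing r (x∈p⇒x∈p∪⁅y⁆ x∈C)

  forced-or-initial : ∀ {W S C D y} (r : Forces G W S C D) → y ∈ D → y ∈ C ⊎ ∃ λ c → c ⇝ y ∈ r
  forced-or-initial done y∈D = inj₁ y∈D
  forced-or-initial (step c u _ _ _ _ _ r) y∈D with forced-or-initial r y∈D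
  ... | inj₂ (c′ , c′⇝y) = inj₂ (c′ , inj₂ c′⇝y)
  ... | inj₁ y∈C∪u with x∈p∪⁅y⁆⁻ y∈C∪u
  ...   | inj₁ y∈C = inj₁ y∈C
  ...   | inj₂ refl = inj₂ (c , inj₁ (refl , refl))

  saturated-forces-nothing : ∀ {W S C D c y} → (∀ {w} → w ∈ W → Adj G c w → w ∈ C) →
                             (r : Forces G W S C D) → ¬ c ⇝ y ∈ r
  saturated-forces-nothing sat (step _ _ _ u∈W u∉C c~u _ _) (inj₁ (refl , refl)) = u∉C (sat u∈W c~u)
  saturated-forces-nothing sat (step _ _ _ _ _ _ _ r) (inj₂ c⇝y) =
    saturated-forces-nothing (λ w∈W c~w → x∈p⇒x∈p∪⁅y⁆ (sat w∈W c~w)) r c⇝y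

  -- x is c itself if c never forces.
  forcing-target : ∀ {W S C D} c (r : Forces G W S C D) →
                   ∃ λ x → c ∈ S ∪ ⁅ x ⁆ × ∀ {y} → c ⇝ y ∈ r → y ≡ x
  forcing-target c done = c , y∈p∪⁅y⁆ , λ ()
  forcing-target {W} {C = C} c (step c′ u c′∈S _ _ _ others r) with c ≟ c′
  ... | yes refl = u , x∈p⇒x∈p∪⁅y⁆ c′∈S , λ
    { (inj₁ (_ , refl)) → refl
    ; (inj₂ c⇝y)        → ⊥-elim (saturated-forces-nothing saturated r c⇝y) }
    where
    saturated : ∀ {w} → w ∈ W → Adj G c w → w ∈ C ∪ ⁅ u ⁆
    saturated {w} w∈W c~w with w ≟ u
    ... | yes refl = y∈p∪⁅y⁆
    ... | no w≢u   = x∈p⇒x∈p∪⁅y⁆ (others w w∈W c~w w≢u)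
  ... | no c≢c′ with forcing-target c r
  ...   | x , c∈S∪x , only-x = x , c∈S∪x , λ
    { (inj₁ (c≡c′ , _)) → ⊥-elim (c≢c′ c≡c′)
    ; (inj₂ c⇝y)        → only-x c⇝y }

  coloured-∪⁅u⁆ : ∀ {W₂ C C₂ : Subset n} {u} → (∀ {y} → y ∈ W₂ → y ∈ C → y ∈ C₂) →
                  (u ∈ W₂ → u ∈ C₂) → ∀ {y} → y ∈ W₂ → y ∈ C ∪ ⁅ u ⁆ → y ∈ C₂
  coloured-∪⁅u⁆ C⊆C₂ u∈C₂ y∈W₂ y∈C∪u with x∈p∪⁅y⁆⁻ y∈C∪u
  ... | inj₁ y∈C = C⊆C₂ y∈W₂ y∈C
  ... | inj₂ refl = u∈C₂ y∈W₂

  -- Forces of r into W₂ are replayed in G[W₂], except those whose target already lies in S₂.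
  Forces-transfer : ∀ {W S C D W₂ S₂ C₂} (r : Forces G W S C D) →
             (∀ {c y} → c ⇝ y ∈ r → y ∈ W₂ → c ∈ S₂ ⊎ y ∈ S₂) → S₂ ⊆ C₂ →
             (∀ {y} → y ∈ W₂ → y ∈ C → y ∈ C₂) → (∀ {y} → y ∈ W₂ → y ∉ W → y ∈ C₂) →
             ∃ λ D₂ → Forces G W₂ S₂ C₂ D₂ × (∀ {y} → y ∈ W₂ → y ∈ D → y ∈ D₂)
  Forces-transfer done _ _ C⊆C₂ _ = _ , done , C⊆C₂
  Forces-transfer {W} {W₂ = W₂} {C₂ = C₂} (step c u _ _ _ c~u others r) allowed S₂⊆C₂ C⊆C₂ outside⊆C₂
    with u ∈? W₂
  ... | no u∉W₂ =
    Forces-transfer r (allowed ∘ inj₂) S₂⊆C₂ (coloured-∪⁅u⁆ C⊆C₂ (⊥-elim ∘ u∉W₂)) outside⊆C₂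
  ... | yes u∈W₂ with u ∈? C₂
  ...   | yes u∈C₂ =
    Forces-transfer r (allowed ∘ inj₂) S₂⊆C₂ (coloured-∪⁅u⁆ C⊆C₂ λ _ → u∈C₂) outside⊆C₂
  ...   | no u∉C₂ with allowed (inj₁ (refl , refl)) u∈W₂
  ...     | inj₂ u∈S₂ = ⊥-elim (u∉C₂ (S₂⊆C₂ u∈S₂))
  ...     | inj₁ c∈S₂ with Forces-transfer r (allowed ∘ inj₂) (x∈p⇒x∈p∪⁅y⁆ ∘ S₂⊆C₂)
                             (coloured-∪⁅u⁆ (λ y∈W₂ → x∈p⇒x∈p∪⁅y⁆ ∘ C⊆C₂ y∈W₂) λ _ → y∈p∪⁅y⁆)
                             (λ y∈W₂ → x∈p⇒x∈p∪⁅y⁆ ∘ outside⊆C₂ y∈W₂)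
  ...       | D₂ , r₂ , D⊆D₂ = D₂ , step c u c∈S₂ u∈W₂ u∉C₂ c~u others₂ r₂ , D⊆D₂
    where
    others₂ : ∀ w → w ∈ W₂ → Adj G c w → w ≢ u → w ∈ C₂
    others₂ w w∈W₂ c~w w≢u with w ∈? W
    ... | yes w∈W = C⊆C₂ w∈W₂ (others w w∈W c~w w≢u)
    ... | no w∉W  = outside⊆C₂ w∈W₂ w∉W

  IsCZFS-restrict : ∀ {W W₂ S S₂ D} (r : Forces G W S S D) → W ⊆ D → W₂ ⊆ W → S₂ ⊆ W₂ →
                    (∀ {y} → y ∈ W₂ → y ∈ S → y ∈ S₂) →
                    (∀ {c y} → c ⇝ y ∈ r → y ∈ W₂ → c ∈ S₂ ⊎ y ∈ S₂) → IsCZFS G W₂ S₂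
  IsCZFS-restrict r W⊆D W₂⊆W S₂⊆W₂ S⊆S₂ allowed
    with Forces-transfer r allowed (λ y∈S₂ → y∈S₂) S⊆S₂ (λ y∈W₂ y∉W → ⊥-elim (y∉W (W₂⊆W y∈W₂)))
  ... | D₂ , r₂ , D⊆D₂ = S₂⊆W₂ , D₂ , r₂ , λ y∈W₂ → D⊆D₂ y∈W₂ (W⊆D (W₂⊆W y∈W₂))

  IsCzf-≡suc : ∀ {W W′ k m} →
            (∀ {S′} → IsCZFS G W′ S′ → ∃ λ S → IsCZFS G W S × ∣ S ∣ ≤ suc ∣ S′ ∣) →
            (∀ {S} → IsCZFS G W S → ∃ λ S′ → IsCZFS G W′ S′ × suc ∣ S′ ∣ ≤ ∣ S ∣) →
            IsCzf G W k → IsCzf G W′ m → k ≡ suc m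
  IsCzf-≡suc {m = m} enlarge reduce ((S , S-czfs , ∣S∣≡k) , k-min) ((S′ , S′-czfs , ∣S′∣≡m) , m-min) =
    ≤-antisym k≤1+m 1+m≤k
    where
    k≤1+m : _ ≤ suc m
    k≤1+m with enlarge S′-czfs
    ... | T , T-czfs , ∣T∣≤1+∣S′∣ =
      ≤-trans (k-min T T-czfs) (subst (λ t → ∣ T ∣ ≤ suc t) ∣S′∣≡m ∣T∣≤1+∣S′∣)
    1+m≤k : suc m ≤ _
    1+m≤k with reduce S-czfs
    ... | T′ , T′-czfs , 1+∣T′∣≤∣S∣ =
      subst (suc m ≤_) ∣S∣≡k (≤-trans (s≤s (m-min T′ T′-czfs)) 1+∣T′∣≤∣S∣)

module PendentEdge {n} (G : Graph n) {a b : Fin n} (a~b : Adj G a b) (a-leaf : HasOnlyNeighbour G a b)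
  where

  a≢b : a ≢ b
  a≢b = Adj-irrefl G a~b

  neighbour-of-rest≢a : ∀ {c y} → Adj G c y → y ∈ ⊤ - a - b → c ≢ a
  neighbour-of-rest≢a c~y y∈W refl with x∈p-y-z⁻ y∈W
  ... | _ , _ , y≢b = y≢b (a-leaf _ c~y)

  b∉S∪⁅a⁆ : ∀ {S} → S ⊆ ⊤ - a - b → b ∉ S ∪ ⁅ a ⁆
  b∉S∪⁅a⁆ S⊆W b∈S∪a with x∈p∪⁅y⁆⁻ b∈S∪a
  ... | inj₁ b∈S with x∈p-y-z⁻ (S⊆W b∈S)
  ...   | _ , _ , b≢b = b≢b refl
  b∉S∪⁅a⁆ S⊆W b∈S∪a | inj₂ refl = a≢b refl

  outside-in-S∪⁅a⁆∪⁅b⁆ : ∀ {S y} → y ∉ ⊤ - a - b → y ∈ (S ∪ ⁅ a ⁆) ∪ ⁅ b ⁆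
  outside-in-S∪⁅a⁆∪⁅b⁆ y∉W with x∉⊤-y-z⇒x≡y⊎x≡z y∉W
  ... | inj₁ refl = x∈p⇒x∈p∪⁅y⁆ y∈p∪⁅y⁆
  ... | inj₂ refl = y∈p∪⁅y⁆

  IsCZFS-add-leaf : ∀ {S} → IsCZFS G (⊤ - a - b) S → IsCZFS G ⊤ (S ∪ ⁅ a ⁆)
  IsCZFS-add-leaf {S} (S⊆W , _ , r , W⊆D)
    with Forces-transfer {W₂ = ⊤} {S₂ = S ∪ ⁅ a ⁆} r (λ c⇝y _ → inj₁ (x∈p⇒x∈p∪⁅y⁆ (forcer-initial c⇝y)))
                      x∈p⇒x∈p∪⁅y⁆ (λ _ → x∈p⇒x∈p∪⁅y⁆ ∘ x∈p⇒x∈p∪⁅y⁆) (λ _ → outside-in-S∪⁅a⁆∪⁅b⁆)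
  ... | D₂ , r₂ , D⊆D₂ =
    (λ _ → ∈⊤) , D₂ , step a b y∈p∪⁅y⁆ ∈⊤ (b∉S∪⁅a⁆ S⊆W) a~b only-b r₂ , ⊤⊆D₂
    where
    only-b : ∀ w → w ∈ ⊤ → Adj G a w → w ≢ b → w ∈ S ∪ ⁅ a ⁆
    only-b w _ a~w w≢b = ⊥-elim (w≢b (a-leaf w a~w))
    ⊤⊆D₂ : ⊤ ⊆ D₂
    ⊤⊆D₂ {y} _ with y ∈? ⊤ - a - b
    ... | yes y∈W = D⊆D₂ ∈⊤ (W⊆D y∈W)
    ... | no y∉W  = forces-increasing r₂ (outside-in-S∪⁅a⁆∪⁅b⁆ y∉W)

  module _ {S D x} {r : Forces G ⊤ S S D} (⊤⊆D : ⊤ ⊆ D) (only-x : ∀ {y} → b ⇝ y ∈ r → y ≡ x) where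

    a∈S∪⁅x⁆ : a ∈ S ∪ ⁅ x ⁆
    a∈S∪⁅x⁆ with forced-or-initial r (⊤⊆D ∈⊤)
    ... | inj₁ a∈S = x∈p⇒x∈p∪⁅y⁆ a∈S
    ... | inj₂ (c , c⇝a) with a-leaf c (Adj-sym G (forcer-adjacent c⇝a))
    ...   | refl with only-x c⇝a
    ...     | refl = y∈p∪⁅y⁆

    IsCZFS-without-edge : IsCZFS G (⊤ - a - b) ((S ∪ ⁅ x ⁆) - a - b)
    IsCZFS-without-edge = IsCZFS-restrict r ⊤⊆D (λ _ → ∈⊤) S′⊆W S∩W⊆S′ allowed
      where
      S′⊆W : (S ∪ ⁅ x ⁆) - a - b ⊆ ⊤ - a - b
      S′⊆W y∈S′ with x∈p-y-z⁻ y∈S′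
      ... | _ , y≢a , y≢b = x∈p-y-z⁺ ∈⊤ y≢a y≢b
      S∩W⊆S′ : ∀ {y} → y ∈ ⊤ - a - b → y ∈ S → y ∈ (S ∪ ⁅ x ⁆) - a - b
      S∩W⊆S′ y∈W y∈S with x∈p-y-z⁻ y∈W
      ... | _ , y≢a , y≢b = x∈p-y-z⁺ (x∈p⇒x∈p∪⁅y⁆ y∈S) y≢a y≢b
      allowed : ∀ {c y} → c ⇝ y ∈ r → y ∈ ⊤ - a - b → c ∈ (S ∪ ⁅ x ⁆) - a - b ⊎ y ∈ (S ∪ ⁅ x ⁆) - a - b
      allowed {c} c⇝y y∈W with c ≟ b | x∈p-y-z⁻ y∈W
      ... | yes refl | _ , y≢a , y≢b =
        inj₂ (x∈p-y-z⁺ (subst (_∈ S ∪ ⁅ x ⁆) (≡-sym (only-x c⇝y)) y∈p∪⁅y⁆) y≢a y≢b)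
      ... | no c≢b   | _ =
        inj₁ (x∈p-y-z⁺ (x∈p⇒x∈p∪⁅y⁆ (forcer-initial c⇝y))
                       (neighbour-of-rest≢a (forcer-adjacent c⇝y) y∈W) c≢b)

  IsCZFS-delete-edge : ∀ {S} → IsCZFS G ⊤ S → ∃ λ S′ → IsCZFS G (⊤ - a - b) S′ × suc ∣ S′ ∣ ≤ ∣ S ∣
  IsCZFS-delete-edge {S} (_ , _ , r , ⊤⊆D) with forcing-target b r
  ... | x , b∈S∪x , only-x =
    (S ∪ ⁅ x ⁆) - a - b , IsCZFS-without-edge ⊤⊆D only-x ,
    s≤s⁻¹ (≤-trans (2+∣p-x-y∣≤∣p∣ (a∈S∪⁅x⁆ ⊤⊆D only-x) b∈S∪x a≢b) (∣p∪⁅x⁆∣≤1+∣p∣ S x))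

  czf-pendent : ∀ k m → IsCzf G ⊤ k → IsCzf G (⊤ - a - b) m → k ≡ suc m
  czf-pendent k m =
    IsCzf-≡suc (λ {S} S-czfs → S ∪ ⁅ a ⁆ , IsCZFS-add-leaf S-czfs , ∣p∪⁅x⁆∣≤1+∣p∣ S a) IsCZFS-delete-edge

mainTheorem10 : ∀ {n} (G : Graph n) (u v : Fin n) → IsPendentEdge G u v →
    ∀ k m → IsCzf G ⊤ k → IsCzf G (⊤ - u - v) m → k ≡ suc m
mainTheorem10 G u v (u~v , inj₁ u-leaf) = PendentEdge.czf-pendent G u~v u-leaf
mainTheorem10 G u v (u~v , inj₂ v-leaf) k m czf-G czf-G-e =
  PendentEdge.czf-pendent G (Adj-sym G u~v) v-leaf k m czf-G
    (subst (λ W → IsCzf G W m) (p─x─y≡p─y─x ⊤ u v) czf-G-e)
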